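{- Let $W$ be any George group of window size $n$ (one of $S_n$, $S^B_n$, $S^D_n$, $\widetilde{S}_n$, $\widetilde{S}^C_n$, $\widetilde{S}^B_n$, $\widetilde{S}^D_n$). If $u,w\in W$, then \[ \operatorname{tvd}(uw)\le \operatorname{tvd}(u)+\operatorname{tvd}(w). \]
   Context: Fix a positive integer $n$, $[n]=\{1,\dots,n\}$, $\pm[n]=\{\pm1,\dots,\pm n\}$. $S_n$: bijections of $[n]$. $S^B_n$: bijections $w$ of $\pm[n]$ with $w(-i)=-w(i)$. $S^D_n$: elements of $S^B_n$ with $\#\{i\in[n]: w(i)<0\}$ even. $\widetilde{S}_n$: bijections $w:\mathbb{Z}\to\mathbb{Z}$ with $w(i+n)=w(i)+n$ for all $i$ and $w(1)+\cdots+w(n)=\binom{n+1}{2}$. $\widetilde{S}^C_n$: bijections $w:\mathbb{Z}\to\mathbb{Z}$ with $w(-i)=-w(i)$ and $w(i+2n+2)=w(i)+2n+2$ for all $i$. $\widetilde{S}^B_n$: elements of $\widetilde{S}^C_n$ with $\#\{i>0: w(i)<0\}$ even. $\widetilde{S}^D_n$: elements of $\widetilde{S}^B_n$ with also $\#\{i>n+1: w(i)<n+1\}$ even. Products are compositions of maps. The total displacement is $\operatorname{tvd}(w)=\sum_{i=1}^n|w(i)-i|$. -}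

module Defs where

open import Data.Nat as ℕ using (ℕ; zero; suc; _%_)
open import Data.Nat.Combinatorics using (_C_)
open import Data.Integer as ℤ using (ℤ; +_; -_; _-_; ∣_∣)
open import Data.List using (List; length)
open import Data.List.Membership.Propositional using (_∈_)
open import Data.List.Relation.Unary.Unique.Propositional using (Unique)
open import Data.Product using (Σ; _×_)
open import Data.Unit using (⊤)
open import Function.Bundles using (_⇔_)
open import Relation.Binary.PropositionalEquality using (_≡_)

data George : Set where
  typeA typeB typeD affA affC affB affD : George

InN : ℕ → ℤ → Set
InN n x = (+ 1 ℤ.≤ x) × (x ℤ.≤ + n)

InPmN : ℕ → ℤ → Set
InPmN n x = (1 ℕ.≤ ∣ x ∣) × (∣ x ∣ ℕ.≤ n)

Dom : George → ℕ → ℤ → Set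
Dom typeA n = InN n
Dom typeB n = InPmN n
Dom typeD n = InPmN n
Dom affA  n = λ _ → ⊤
Dom affC  n = λ _ → ⊤
Dom affB  n = λ _ → ⊤
Dom affD  n = λ _ → ⊤

-- A bijection of the subset X ⊆ ℤ, given by maps ℤ → ℤ
-- (their values outside X are irrelevant).
record BijOn (X : ℤ → Set) : Set where
  field
    fun    : ℤ → ℤ
    inv    : ℤ → ℤ
    fun-X  : ∀ x → X x → X (fun x)
    inv-X  : ∀ x → X x → X (inv x)
    inv∘fun : ∀ x → X x → inv (fun x) ≡ x
    fun∘inv : ∀ x → X x → fun (inv x) ≡ x
open BijOn public

EvenCard : (ℤ → Set) → Set
EvenCard P = Σ (List ℤ) λ xs → Unique xs × (∀ x → (x ∈ xs ⇔ P x)) × (length xs % 2 ≡ 0)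

sumℤ : ℕ → (ℤ → ℤ) → ℤ
sumℤ zero    f = + 0
sumℤ (suc k) f = sumℤ k f ℤ.+ f (+ suc k)

sumℕ : ℕ → (ℤ → ℕ) → ℕ
sumℕ zero    f = 0
sumℕ (suc k) f = sumℕ k f ℕ.+ f (+ suc k)

Odd-symmetric : (ℤ → ℤ) → Set
Odd-symmetric w = ∀ i → w (- i) ≡ - w i

CondC : ℕ → (ℤ → ℤ) → Set
CondC n w = Odd-symmetric w
          × (∀ i → w (i ℤ.+ + (2 ℕ.* n ℕ.+ 2)) ≡ w i ℤ.+ + (2 ℕ.* n ℕ.+ 2))

Cond : (g : George) (n : ℕ) → (ℤ → ℤ) → Set
Cond typeA n w = ⊤
Cond typeB n w = ∀ i → InPmN n i → w (- i) ≡ - w i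
Cond typeD n w = (∀ i → InPmN n i → w (- i) ≡ - w i)
               × EvenCard (λ i → InN n i × (w i ℤ.< + 0))
Cond affA n w = (∀ i → w (i ℤ.+ + n) ≡ w i ℤ.+ + n)
              × (sumℤ n w ≡ + (suc n C 2))
Cond affC n w = CondC n w
Cond affB n w = CondC n w
              × EvenCard (λ i → (+ 0 ℤ.< i) × (w i ℤ.< + 0))
Cond affD n w = CondC n w
              × EvenCard (λ i → (+ 0 ℤ.< i) × (w i ℤ.< + 0))
              × EvenCard (λ i → (+ suc n ℤ.< i) × (w i ℤ.< + suc n))

record Elem (g : George) (n : ℕ) : Set where
  field
    bij  : BijOn (Dom g n)
    cond : Cond g n (fun bij)
open Elem public

⟦_⟧ : ∀ {g n} → Elem g n → ℤ → ℤ
⟦ u ⟧ = fun (bij u)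

tvd : ℕ → (ℤ → ℤ) → ℕ
tvd n w = sumℕ n (λ i → ∣ w i - i ∣)

-- By the triangle inequality, tvd(uw) is at most Σ_{i ∈ [n]} |u(w i) − w i| + tvd(w), so it
-- suffices that this sum equals tvd(u).  The displacement x ↦ |u x − x| is constant on the
-- orbits of the symmetries that every element of the group commutes with (negation, and
-- translation by the period), and the window [n] meets each orbit at most once.  Sending
-- w i to the representative of its orbit therefore defines a permutation of [n], with
-- inverse coming from w⁻¹, and the sum is a rearrangement of tvd(u).  In the affine types
-- C, B, D the representatives range over [0, n+1]; the orbits of 0 and n+1 are fixed by
-- every element, so the window points are sent back into the window.
module Submission where

open import Defs
open import Data.Empty using (⊥-elim)
open import Data.Integer as ℤ using (ℤ; +_; -[1+_]; +≤+; -_; _+_; _-_; _*_; ∣_∣)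
open import Data.Integer.DivMod using (_%ℕ_; _/ℕ_; n%ℕd<d; a≡a%ℕn+[a/ℕn]*n)
import Data.Integer.Properties as ℤ
open import Data.Integer.Tactic.RingSolver using (solve-∀)
open import Data.List using (List; map; applyDownFrom)
open import Data.List.Membership.Propositional using (_∈_)
open import Data.List.Membership.Propositional.Properties
  using (∈-map⁺; ∈-map⁻; ∈-applyDownFrom⁺; ∈-applyDownFrom⁻)
open import Data.List.Membership.Propositional.Properties.WithK using (unique∧set⇒bag)
open import Data.List.Properties using (map-∘; map-id-local; map-cong-local)
open import Data.List.Relation.Binary.BagAndSetEquality using (∼bag⇒↭)
open import Data.List.Relation.Binary.Permutation.Propositional using (_↭_)
import Data.List.Relation.Binary.Permutation.Propositional.Properties as ↭
import Data.List.Relation.Unary.All as All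
open import Data.List.Relation.Unary.Unique.Propositional using (Unique)
import Data.List.Relation.Unary.Unique.Propositional.Properties as Unique
open import Data.Nat as ℕ using (ℕ; zero; suc; _≤_; _<_; _∸_; z≤n; s≤s; z<s)
open import Data.Nat.DivMod using (_%_; m<n⇒m%n≡m; [m+kn]%n≡m%n)
open import Data.Nat.ListAction using (sum)
open import Data.Nat.ListAction.Properties using (sum-↭)
import Data.Nat.Properties as ℕ
open import Algebra.Properties.CommutativeSemigroup ℕ.+-commutativeSemigroup
  using () renaming (interchange to +-interchange)
import Data.Nat.Tactic.RingSolver as ℕ-Solver
open import Data.Product using (_,_; _×_; proj₁)
open import Data.Sum using (_⊎_; inj₁; inj₂; [_,_]′)
open import Data.Unit using (⊤; tt)
open import Function.Base using (_∘_)
open import Function.Bundles using (mk⇔)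
open import Relation.Binary.PropositionalEquality
open import Relation.Binary.Structures using (IsEquivalence)
open import Relation.Nullary using (¬_)

window : ℕ → List ℤ
window = applyDownFrom (λ k → + suc k)

∈-window⁺ : ∀ {n x} → InN n x → x ∈ window n
∈-window⁺ {x = + suc k} (_ , +≤+ k<n) = ∈-applyDownFrom⁺ _ k<n
∈-window⁺ {x = + zero} (+≤+ () , _)

∈-window⁻ : ∀ {n x} → x ∈ window n → InN n x
∈-window⁻ x∈ with ∈-applyDownFrom⁻ _ x∈
... | k , k<n , refl = +≤+ (s≤s z≤n) , +≤+ k<n

window-unique : ∀ n → Unique (window n)
window-unique n =
  Unique.applyDownFrom⁺₁ _ n λ j<i _ e → ℕ.<-irrefl (sym (ℤ.+-injective e)) (s≤s j<i)

sumℕ≡sum-window : ∀ n f → sumℕ n f ≡ sum (map f (window n))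
sumℕ≡sum-window zero    f = refl
sumℕ≡sum-window (suc n) f =
  trans (cong (ℕ._+ f (+ suc n)) (sumℕ≡sum-window n f)) (ℕ.+-comm _ (f (+ suc n)))

sumℕ-cong : ∀ n {f g : ℤ → ℕ} → (∀ {i} → InN n i → f i ≡ g i) → sumℕ n f ≡ sumℕ n g
sumℕ-cong n {f} {g} f≗g = begin
  sumℕ n f               ≡⟨ sumℕ≡sum-window n f ⟩
  sum (map f (window n)) ≡⟨ cong sum (map-cong-local (All.tabulate (f≗g ∘ ∈-window⁻))) ⟩
  sum (map g (window n)) ≡⟨ sumℕ≡sum-window n g ⟨
  sumℕ n g               ∎
  where open ≡-Reasoning

sumℕ-mono : ∀ n {f g : ℤ → ℕ} → (∀ i → f i ≤ g i) → sumℕ n f ≤ sumℕ n g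
sumℕ-mono zero    f≤g = z≤n
sumℕ-mono (suc n) f≤g = ℕ.+-mono-≤ (sumℕ-mono n f≤g) (f≤g _)

sumℕ-+ : ∀ n (f g : ℤ → ℕ) → sumℕ n (λ i → f i ℕ.+ g i) ≡ sumℕ n f ℕ.+ sumℕ n g
sumℕ-+ zero    f g = refl
sumℕ-+ (suc n) f g = trans (cong (ℕ._+ (f (+ suc n) ℕ.+ g (+ suc n))) (sumℕ-+ n f g))
  (+-interchange (sumℕ n f) (sumℕ n g) _ _)

sumℕ-permute : ∀ n (f : ℤ → ℕ) (σ : BijOn (InN n)) → sumℕ n (f ∘ fun σ) ≡ sumℕ n f
sumℕ-permute n f σ = begin
  sumℕ n (f ∘ fun σ)              ≡⟨ sumℕ≡sum-window n (f ∘ fun σ) ⟩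
  sum (map (f ∘ fun σ) (window n)) ≡⟨ cong sum (map-∘ (window n)) ⟩
  sum (map f σ[window])            ≡⟨ sum-↭ (↭.map⁺ f σ[window]↭window) ⟩
  sum (map f (window n))           ≡⟨ sumℕ≡sum-window n f ⟨
  sumℕ n f                         ∎
  where
  open ≡-Reasoning
  σ[window] : List ℤ
  σ[window] = map (fun σ) (window n)

  inv∘σ[window] : map (inv σ) σ[window] ≡ window n
  inv∘σ[window] = trans (sym (map-∘ (window n)))
    (map-id-local (All.tabulate (inv∘fun σ _ ∘ ∈-window⁻)))

  σ[window]-unique : Unique σ[window]
  σ[window]-unique = Unique.map⁻ (subst Unique (sym inv∘σ[window]) (window-unique n))

  σ[window]↭window : σ[window] ↭ window n
  σ[window]↭window = ∼bag⇒↭ (unique∧set⇒bag σ[window]-unique (window-unique n) (mk⇔ ⇒ ⇐))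
    where
    ⇒ : ∀ {y} → y ∈ σ[window] → y ∈ window n
    ⇒ y∈ with ∈-map⁻ (fun σ) y∈
    ... | x , x∈ , refl = ∈-window⁺ (fun-X σ x (∈-window⁻ x∈))
    ⇐ : ∀ {y} → y ∈ window n → y ∈ σ[window]
    ⇐ {y} y∈ = subst (_∈ σ[window]) (fun∘inv σ y (∈-window⁻ y∈))
      (∈-map⁺ (fun σ) (∈-window⁺ (inv-X σ y (∈-window⁻ y∈))))

disp : (ℤ → ℤ) → ℤ → ℕ
disp u x = ∣ u x - x ∣

disp-∘-≤ : ∀ u w x → disp (u ∘ w) x ≤ disp u (w x) ℕ.+ disp w x
disp-∘-≤ u w x = subst (λ d → ∣ d ∣ ≤ disp u (w x) ℕ.+ disp w x)
  (sym (split (u (w x)) (w x) x)) (ℤ.∣i+j∣≤∣i∣+∣j∣ (u (w x) - w x) (w x - x))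
  where
  split : ∀ a b c → a - c ≡ (a - b) + (b - c)
  split = solve-∀

disp-odd : ∀ u y → u (- y) ≡ - u y → disp u (- y) ≡ disp u y
disp-odd u y odd = begin
  ∣ u (- y) - - y ∣ ≡⟨ cong (λ v → ∣ v - - y ∣) odd ⟩
  ∣ - u y - - y ∣   ≡⟨ cong ∣_∣ (negate (u y) y) ⟩
  ∣ - (u y - y) ∣   ≡⟨ ℤ.∣-i∣≡∣i∣ (u y - y) ⟩
  ∣ u y - y ∣       ∎
  where
  open ≡-Reasoning
  negate : ∀ a b → - a - - b ≡ - (a - b)
  negate = solve-∀

tvd-∘-≤-by-permutation : ∀ n (u w : ℤ → ℤ) (σ : BijOn (InN n)) →
  (∀ {i} → InN n i → disp u (w i) ≡ disp u (fun σ i)) →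
  tvd n (u ∘ w) ≤ tvd n u ℕ.+ tvd n w
tvd-∘-≤-by-permutation n u w σ disp-w≡disp-σ = begin
  tvd n (u ∘ w)                            ≤⟨ sumℕ-mono n (disp-∘-≤ u w) ⟩
  sumℕ n (λ i → disp u (w i) ℕ.+ disp w i) ≡⟨ sumℕ-+ n (disp u ∘ w) (disp w) ⟩
  sumℕ n (disp u ∘ w) ℕ.+ tvd n w          ≡⟨ cong (ℕ._+ tvd n w) (sumℕ-cong n disp-w≡disp-σ) ⟩
  sumℕ n (disp u ∘ fun σ) ℕ.+ tvd n w      ≡⟨ cong (ℕ._+ tvd n w) (sumℕ-permute n (disp u) σ) ⟩
  tvd n u ℕ.+ tvd n w                      ∎
  where open ℕ.≤-Reasoning

inv-commutes : ∀ {X} (w : BijOn X) (σ : ℤ → ℤ) → (∀ x → X x → X (σ x)) →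
  (∀ x → X x → fun w (σ x) ≡ σ (fun w x)) →
  ∀ x → X x → inv w (σ x) ≡ σ (inv w x)
inv-commutes w σ σ-X w∘σ x x∈ = begin
  inv w (σ x)                   ≡⟨ cong (inv w ∘ σ) (fun∘inv w x x∈) ⟨
  inv w (σ (fun w (inv w x)))   ≡⟨ cong (inv w) (w∘σ _ (inv-X w x x∈)) ⟨
  inv w (fun w (σ (inv w x)))   ≡⟨ inv∘fun w _ (σ-X _ (inv-X w x x∈)) ⟩
  σ (inv w x)                   ∎
  where open ≡-Reasoning

RespectsOn : (ℤ → Set) → (ℤ → ℤ → Set) → (ℤ → ℤ) → Set
RespectsOn X _~_ f = ∀ {x y} → X x → X y → x ~ y → f x ~ f y

module Folding {X : ℤ → Set} {_~_ : ℤ → ℤ → Set} (n : ℕ) (rep : ℤ → ℤ)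
  (rep-~ : ∀ x → rep x ~ x) (rep-resp : ∀ {x y} → x ~ y → rep x ≡ rep y)
  (rep-X : ∀ x → X x → X (rep x))
  (rep-fix : ∀ {i} → InN n i → rep i ≡ i) (window-X : ∀ {i} → InN n i → X i) where

  FoldsInto : (ℤ → ℤ) → Set
  FoldsInto f = ∀ {i} → InN n i → InN n (rep (f i))

  rep-cancel : ∀ {f g : ℤ → ℤ} → (∀ x → X x → X (f x)) → RespectsOn X _~_ g →
    (∀ x → X x → g (f x) ≡ x) → ∀ {i} → InN n i → rep (g (rep (f i))) ≡ i
  rep-cancel {f} {g} f-X g-resp g∘f {i} i∈ = begin
    rep (g (rep (f i))) ≡⟨ rep-resp (g-resp {rep (f i)} (rep-X _ fi∈) fi∈ (rep-~ (f i))) ⟩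
    rep (g (f i))       ≡⟨ cong rep (g∘f i (window-X i∈)) ⟩
    rep i               ≡⟨ rep-fix i∈ ⟩
    i                   ∎
    where
    open ≡-Reasoning
    fi∈ : X (f i)
    fi∈ = f-X i (window-X i∈)

  fold : (w : BijOn X) → RespectsOn X _~_ (fun w) → RespectsOn X _~_ (inv w) →
    FoldsInto (fun w) → FoldsInto (inv w) → BijOn (InN n)
  fold w fun-resp inv-resp fun-into inv-into = record
    { fun     = rep ∘ fun w
    ; inv     = rep ∘ inv w
    ; fun-X   = λ i → fun-into {i}
    ; inv-X   = λ i → inv-into {i}
    ; inv∘fun = λ i → rep-cancel {fun w} {inv w} (fun-X w) inv-resp (inv∘fun w) {i}
    ; fun∘inv = λ i → rep-cancel {inv w} {fun w} (inv-X w) fun-resp (fun∘inv w) {i}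
    }

  tvd-∘-≤-by-folding : ∀ u (w : BijOn X) → RespectsOn X _~_ (fun w) → RespectsOn X _~_ (inv w) →
    FoldsInto (fun w) → FoldsInto (inv w) → (∀ x → X x → disp u (rep x) ≡ disp u x) →
    tvd n (u ∘ fun w) ≤ tvd n u ℕ.+ tvd n (fun w)
  tvd-∘-≤-by-folding u w fun-resp inv-resp fun-into inv-into disp-rep =
    tvd-∘-≤-by-permutation n u (fun w) (fold w fun-resp inv-resp fun-into inv-into)
      (λ i∈ → sym (disp-rep _ (fun-X w _ (window-X i∈))))

infix 4 _≡±_
_≡±_ : ℤ → ℤ → Set
x ≡± y = x ≡ y ⊎ x ≡ - y

module Signed (n : ℕ) where

  OddOn : (ℤ → ℤ) → Set
  OddOn f = ∀ i → InPmN n i → f (- i) ≡ - f i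

  InN⇒InPmN : ∀ {i} → InN n i → InPmN n i
  InN⇒InPmN {+ _} (+≤+ 1≤i , +≤+ i≤n) = 1≤i , i≤n

  InPmN-neg : ∀ x → InPmN n x → InPmN n (- x)
  InPmN-neg x = subst (λ m → 1 ≤ m × m ≤ n) (sym (ℤ.∣-i∣≡∣i∣ x))

  InPmN⇒InN-abs : ∀ x → InPmN n x → InN n (+ ∣ x ∣)
  InPmN⇒InN-abs _ (1≤∣x∣ , ∣x∣≤n) = +≤+ 1≤∣x∣ , +≤+ ∣x∣≤n

  abs-≡± : ∀ x → + ∣ x ∣ ≡± x
  abs-≡± (+ _)    = inj₁ refl
  abs-≡± -[1+ _ ] = inj₂ refl

  abs-fix : ∀ {i} → InN n i → + ∣ i ∣ ≡ i
  abs-fix {+ _} _ = refl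

  abs-resp : ∀ {x y} → x ≡± y → + ∣ x ∣ ≡ + ∣ y ∣
  abs-resp (inj₁ refl)         = refl
  abs-resp {y = y} (inj₂ refl) = cong +_ (ℤ.∣-i∣≡∣i∣ y)

  odd-respects : ∀ {f} → OddOn f → RespectsOn (InPmN n) _≡±_ f
  odd-respects odd _  _  (inj₁ refl) = inj₁ refl
  odd-respects odd _ y∈ (inj₂ refl) = inj₂ (odd _ y∈)

  disp-abs : ∀ u → OddOn u → ∀ x → InPmN n x → disp u (+ ∣ x ∣) ≡ disp u x
  disp-abs u odd (+ _)      _  = refl
  disp-abs u odd -[1+ m ] x∈ = sym (disp-odd u (+ suc m) (odd (+ suc m) (InPmN-neg -[1+ m ] x∈)))

  open Folding {InPmN n} {_≡±_} n (λ x → + ∣ x ∣) abs-≡± abs-resp (λ _ x∈ → x∈)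
    abs-fix InN⇒InPmN

  tvd-subadditive : ∀ (u w : BijOn (InPmN n)) → OddOn (fun u) → OddOn (fun w) →
    tvd n (fun u ∘ fun w) ≤ tvd n (fun u) ℕ.+ tvd n (fun w)
  tvd-subadditive u w u-odd w-odd =
    tvd-∘-≤-by-folding (fun u) w (odd-respects w-odd) (odd-respects w⁻¹-odd)
      (λ {i} i∈ → InPmN⇒InN-abs (fun w i) (fun-X w i (InN⇒InPmN i∈)))
      (λ {i} i∈ → InPmN⇒InN-abs (inv w i) (inv-X w i (InN⇒InPmN i∈)))
      (disp-abs (fun u) u-odd)
    where
    w⁻¹-odd : OddOn (inv w)
    w⁻¹-odd = inv-commutes w -_ InPmN-neg w-odd

infix 4 _≡_mod_ _≡±_mod_

record _≡_mod_ (x y : ℤ) (N : ℕ) : Set where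
  constructor congruent
  field
    k  : ℤ
    eq : x ≡ y + k * + N

module _ {N : ℕ} where

  mod-refl : ∀ {x} → x ≡ x mod N
  mod-refl {x} = congruent (+ 0) (sym (ℤ.+-identityʳ x))

  mod-sym : ∀ {x y} → x ≡ y mod N → y ≡ x mod N
  mod-sym {y = y} (congruent k x≡) =
    congruent (- k) (trans (cancel y k (+ N)) (cong (λ v → v + - k * + N) (sym x≡)))
    where
    cancel : ∀ y k M → y ≡ y + k * M + - k * M
    cancel = solve-∀

  mod-trans : ∀ {x y z} → x ≡ y mod N → y ≡ z mod N → x ≡ z mod N
  mod-trans {z = z} (congruent k x≡) (congruent l y≡) =
    congruent (l + k) (trans x≡ (trans (cong (λ v → v + k * + N) y≡) (collect z k l (+ N))))
    where
    collect : ∀ z k l M → z + l * M + k * M ≡ z + (l + k) * M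
    collect = solve-∀

  mod-isEquivalence : IsEquivalence (λ x y → x ≡ y mod N)
  mod-isEquivalence = record { refl = mod-refl ; sym = mod-sym ; trans = mod-trans }

  mod-neg : ∀ {x y} → x ≡ y mod N → - x ≡ - y mod N
  mod-neg {y = y} (congruent k x≡) = congruent (- k) (trans (cong -_ x≡) (negate y k (+ N)))
    where
    negate : ∀ y k M → - (y + k * M) ≡ - y + - k * M
    negate = solve-∀

  mod-+ʳ : ∀ c {x y} → x ≡ y mod N → x + c ≡ y + c mod N
  mod-+ʳ c {y = y} (congruent k x≡) = congruent k (trans (cong (_+ c) x≡) (swap y k c (+ N)))
    where
    swap : ∀ y k c M → y + k * M + c ≡ y + c + k * M
    swap = solve-∀

  residue-unique : ∀ .{{_ : ℕ.NonZero N}} {s t k} → s < N → t < N →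
    + s ≡ + t + + k * + N → s ≡ t
  residue-unique {s} {t} {k} s<N t<N s≡ = begin
    s                   ≡⟨ m<n⇒m%n≡m s<N ⟨
    s % N               ≡⟨ cong (_% N) (ℤ.+-injective (trans s≡ t+kN≡)) ⟩
    (t ℕ.+ k ℕ.* N) % N ≡⟨ [m+kn]%n≡m%n t k N ⟩
    t % N               ≡⟨ m<n⇒m%n≡m t<N ⟩
    t                   ∎
    where
    open ≡-Reasoning
    t+kN≡ : + t + + k * + N ≡ + (t ℕ.+ k ℕ.* N)
    t+kN≡ = trans (cong (λ v → + t + v) (sym (ℤ.pos-* k N))) (sym (ℤ.pos-+ t (k ℕ.* N)))

  mod-unique : ∀ .{{_ : ℕ.NonZero N}} {s t} → s < N → t < N → + s ≡ + t mod N → s ≡ t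
  mod-unique s<N t<N (congruent (+ k) s≡) = residue-unique {k = k} s<N t<N s≡
  mod-unique s<N t<N s≡t@(congruent -[1+ k ] _) =
    sym (residue-unique {k = suc k} t<N s<N (_≡_mod_.eq (mod-sym s≡t)))

data _≡±_mod_ (x y : ℤ) (N : ℕ) : Set where
  plus  : x ≡ y mod N → x ≡± y mod N
  minus : x ≡ - y mod N → x ≡± y mod N

module _ {N : ℕ} where

  ±-isEquivalence : IsEquivalence (λ x y → x ≡± y mod N)
  ±-isEquivalence = record { refl = plus mod-refl ; sym = ±-sym ; trans = ±-trans }
    where
    neg-mod : ∀ {x y} → x ≡ - y mod N → - x ≡ y mod N
    neg-mod {y = y} = subst (λ v → _ ≡ v mod N) (ℤ.neg-involutive y) ∘ mod-neg

    ±-sym : ∀ {x y} → x ≡± y mod N → y ≡± x mod N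
    ±-sym (plus x≡y)   = plus (mod-sym x≡y)
    ±-sym (minus x≡-y) = minus (mod-sym (neg-mod x≡-y))

    ±-trans : ∀ {x y z} → x ≡± y mod N → y ≡± z mod N → x ≡± z mod N
    ±-trans (plus x≡y)   (plus y≡z)   = plus (mod-trans x≡y y≡z)
    ±-trans (plus x≡y)   (minus y≡-z) = minus (mod-trans x≡y y≡-z)
    ±-trans (minus x≡-y) (plus y≡z)   = minus (mod-trans x≡-y (mod-neg y≡z))
    ±-trans (minus x≡-y) (minus y≡-z) = plus (mod-trans x≡-y (neg-mod y≡-z))

Periodic : ℕ → (ℤ → ℤ) → Set
Periodic N f = ∀ i → f (i + + N) ≡ f i + + N

module _ {N : ℕ} {f : ℤ → ℤ} (f-periodic : Periodic N f) where

  periodic-shift⁺ : ∀ x k → f (x + + k * + N) ≡ f x + + k * + N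
  periodic-shift⁺ x zero    = trans (cong f (ℤ.+-identityʳ x)) (sym (ℤ.+-identityʳ (f x)))
  periodic-shift⁺ x (suc k) = begin
    f (x + + suc k * + N)     ≡⟨ cong f (step x (+ k) (+ N)) ⟩
    f (x + + k * + N + + N)   ≡⟨ f-periodic _ ⟩
    f (x + + k * + N) + + N   ≡⟨ cong (_+ + N) (periodic-shift⁺ x k) ⟩
    f x + + k * + N + + N     ≡⟨ step (f x) (+ k) (+ N) ⟨
    f x + + suc k * + N       ∎
    where
    open ≡-Reasoning
    step : ∀ x k M → x + (+ 1 + k) * M ≡ x + k * M + M
    step = solve-∀

  periodic-shift : ∀ x k → f (x + k * + N) ≡ f x + k * + N
  periodic-shift x (+ k)    = periodic-shift⁺ x k
  periodic-shift x -[1+ k ] = _≡_mod_.eq (mod-sym (congruent (+ suc k) f-x≡))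
    where
    z = x + -[1+ k ] * + N
    unshift : ∀ x k M → x ≡ x + - k * M + k * M
    unshift = solve-∀
    f-x≡ : f x ≡ f z + + suc k * + N
    f-x≡ = trans (cong f (unshift x (+ suc k) (+ N))) (periodic-shift⁺ z (suc k))

  periodic-resp : ∀ {x y} → x ≡ y mod N → f x ≡ f y mod N
  periodic-resp {y = y} (congruent k x≡) = congruent k (trans (cong f x≡) (periodic-shift y k))

  disp-periodic : ∀ {x y} → x ≡ y mod N → disp f x ≡ disp f y
  disp-periodic {y = y} (congruent k refl) = trans
    (cong (λ v → ∣ v - (y + k * + N) ∣) (periodic-shift y k))
    (cong ∣_∣ (cancel (f y) y k (+ N)))
    where
    cancel : ∀ a y k M → a + k * M - (y + k * M) ≡ a - y
    cancel = solve-∀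

module _ {N : ℕ} {f : ℤ → ℤ} (f-odd : Odd-symmetric f) (f-periodic : Periodic N f) where

  odd-periodic-resp : ∀ {x y} → x ≡± y mod N → f x ≡± f y mod N
  odd-periodic-resp (plus x≡y)             = plus (periodic-resp {f = f} f-periodic x≡y)
  odd-periodic-resp {y = y} (minus x≡-y) =
    minus (subst (λ v → _ ≡ v mod N) (f-odd y) (periodic-resp {f = f} f-periodic x≡-y))

  disp-odd-periodic : ∀ {x y} → x ≡± y mod N → disp f x ≡ disp f y
  disp-odd-periodic (plus x≡y)             = disp-periodic {f = f} f-periodic x≡y
  disp-odd-periodic {y = y} (minus x≡-y) =
    trans (disp-periodic {f = f} f-periodic x≡-y) (disp-odd f y (f-odd y))

inv-periodic : ∀ {N} (w : BijOn (λ _ → ⊤)) → Periodic N (fun w) → Periodic N (inv w)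
inv-periodic {N} w w-periodic x = inv-commutes w (_+ + N) _ (λ x _ → w-periodic x) x tt

inv-odd : ∀ (w : BijOn (λ _ → ⊤)) → Odd-symmetric (fun w) → Odd-symmetric (inv w)
inv-odd w w-odd x = inv-commutes w -_ _ (λ x _ → w-odd x) x tt

module Transversal {_~_ : ℤ → ℤ → Set} (~-isEquivalence : IsEquivalence _~_) {D : ℤ → Set}
  (D-unique : ∀ {s t} → D s → D t → s ~ t → s ≡ t)
  (rep : ℤ → ℤ) (rep-D : ∀ x → D (rep x)) (rep-~ : ∀ x → rep x ~ x) where

  open IsEquivalence ~-isEquivalence renaming (sym to ~-sym; trans to ~-trans)

  rep-resp : ∀ {x y} → x ~ y → rep x ≡ rep y
  rep-resp {x} {y} x~y = D-unique (rep-D x) (rep-D y) (~-trans (rep-~ x) (~-trans x~y (~-sym (rep-~ y))))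

  rep-fix : ∀ {s} → D s → rep s ≡ s
  rep-fix {s} s∈ = D-unique (rep-D s) s∈ (rep-~ s)

module AffineA (n : ℕ) .{{_ : ℕ.NonZero n}} where

  rep : ℤ → ℤ
  rep x = + suc ((x - + 1) %ℕ n)

  rep-InN : ∀ x → InN n (rep x)
  rep-InN x = +≤+ (s≤s z≤n) , +≤+ (n%ℕd<d (x - + 1) n)

  rep-≡ : ∀ x → rep x ≡ x mod n
  rep-≡ x = mod-sym (congruent ((x - + 1) /ℕ n) (begin
    x                              ≡⟨ unshift x ⟩
    + 1 + (x - + 1)                ≡⟨ cong (_+_ (+ 1)) (a≡a%ℕn+[a/ℕn]*n (x - + 1) n) ⟩
    + 1 + (+ r + q * + n)          ≡⟨ ℤ.+-assoc (+ 1) (+ r) (q * + n) ⟨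
    rep x + q * + n                ∎))
    where
    open ≡-Reasoning
    r = (x - + 1) %ℕ n
    q = (x - + 1) /ℕ n
    unshift : ∀ x → x ≡ + 1 + (x - + 1)
    unshift = solve-∀

  InN-unique : ∀ {s t} → InN n s → InN n t → s ≡ t mod n → s ≡ t
  InN-unique {+ suc a} {+ suc b} (_ , +≤+ a<n) (_ , +≤+ b<n) s≡t =
    cong (+_ ∘ suc) (mod-unique a<n b<n (mod-+ʳ ℤ.-1ℤ s≡t))
  InN-unique {+ zero}     (+≤+ () , _) _            _
  InN-unique {t = + zero} _            (+≤+ () , _) _

  open Transversal mod-isEquivalence InN-unique rep rep-InN rep-≡
  open Folding {λ _ → ⊤} {λ x y → x ≡ y mod n} n rep rep-≡ rep-resp _ rep-fix _

  tvd-subadditive : ∀ (u w : BijOn (λ _ → ⊤)) → Periodic n (fun u) → Periodic n (fun w) →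
    tvd n (fun u ∘ fun w) ≤ tvd n (fun u) ℕ.+ tvd n (fun w)
  tvd-subadditive u w u-periodic w-periodic =
    tvd-∘-≤-by-folding (fun u) w
      (λ _ _ → periodic-resp w-periodic) (λ _ _ → periodic-resp (inv-periodic w w-periodic))
      (λ {i} _ → rep-InN (fun w i)) (λ {i} _ → rep-InN (inv w i))
      (λ x _ → disp-periodic {f = fun u} u-periodic (rep-≡ x))

i≡-i⇒i≡0 : ∀ x → x ≡ - x → x ≡ + 0
i≡-i⇒i≡0 (+ zero) _ = refl

odd-fixes-0 : ∀ {f} → Odd-symmetric f → f (+ 0) ≡ + 0
odd-fixes-0 f-odd = i≡-i⇒i≡0 _ (f-odd (+ 0))

module AffineC (n : ℕ) where

  H N : ℕ
  H = suc n
  N = 2 ℕ.* n ℕ.+ 2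

  N≡H+H : N ≡ H ℕ.+ H
  N≡H+H = ℕ-ring n
    where
    ℕ-ring : ∀ n → 2 ℕ.* n ℕ.+ 2 ≡ suc n ℕ.+ suc n
    ℕ-ring = ℕ-Solver.solve-∀

  instance
    N-nonZero : ℕ.NonZero N
    N-nonZero = subst ℕ.NonZero (sym N≡H+H) _

  H<N : H < N
  H<N = subst (H <_) (sym N≡H+H) (ℕ.m<m+n H z<s)

  InHalfPeriod : ℤ → Set
  InHalfPeriod s = (+ 0 ℤ.≤ s) × (s ℤ.≤ + H)

  m+n≡H+H⇒m≡H : ∀ {a b} → a ≤ H → b ≤ H → a ℕ.+ b ≡ H ℕ.+ H → a ≡ H
  m+n≡H+H⇒m≡H {a} {b} a≤H b≤H a+b≡ = ℕ.≤-antisym a≤H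
    (ℕ.+-cancelʳ-≤ H H a (subst (_≤ a ℕ.+ H) a+b≡ (ℕ.+-monoʳ-≤ a b≤H)))

  antipodal-unique : ∀ {a b} → a ≤ H → b ≤ H → + a ≡ - + b mod N → a ≡ b
  antipodal-unique {a} {b} a≤H b≤H (congruent k a≡) =
    [ (λ a+b<N → zero-sum (mod-unique a+b<N (ℕ.<-trans z<s H<N) (congruent k a+b≡kN)))
    , (λ a+b≡N → full-sum (trans a+b≡N N≡H+H))
    ]′ (ℕ.m≤n⇒m<n∨m≡n a+b≤N)
    where
    a+b≤N : a ℕ.+ b ≤ N
    a+b≤N = subst (a ℕ.+ b ≤_) (sym N≡H+H) (ℕ.+-mono-≤ a≤H b≤H)
    cancel : ∀ b k M → - b + k * M + b ≡ + 0 + k * M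
    cancel = solve-∀
    a+b≡kN : + (a ℕ.+ b) ≡ + 0 + k * + N
    a+b≡kN = trans (ℤ.pos-+ a b) (trans (cong (_+ + b) a≡) (cancel (+ b) k (+ N)))
    zero-sum : a ℕ.+ b ≡ 0 → a ≡ b
    zero-sum a+b≡0 = trans (ℕ.m+n≡0⇒m≡0 a a+b≡0) (sym (ℕ.m+n≡0⇒n≡0 a a+b≡0))
    full-sum : a ℕ.+ b ≡ H ℕ.+ H → a ≡ b
    full-sum a+b≡ = trans (m+n≡H+H⇒m≡H a≤H b≤H a+b≡)
      (sym (m+n≡H+H⇒m≡H b≤H a≤H (trans (ℕ.+-comm b a) a+b≡)))

  InN⇒InHalfPeriod : ∀ {i} → InN n i → InHalfPeriod i
  InN⇒InHalfPeriod {+ _} (_ , +≤+ i≤n) = +≤+ z≤n , +≤+ (ℕ.m≤n⇒m≤1+n i≤n)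

  InHalfPeriod-unique : ∀ {s t} → InHalfPeriod s → InHalfPeriod t → s ≡± t mod N → s ≡ t
  InHalfPeriod-unique {+ a} {+ b} (_ , +≤+ a≤H) (_ , +≤+ b≤H) (plus s≡t) =
    cong +_ (mod-unique (ℕ.≤-<-trans a≤H H<N) (ℕ.≤-<-trans b≤H H<N) s≡t)
  InHalfPeriod-unique {+ a} {+ b} (_ , +≤+ a≤H) (_ , +≤+ b≤H) (minus s≡-t) =
    cong +_ (antipodal-unique a≤H b≤H s≡-t)

  reflect : ℕ → ℕ
  reflect r = r ℕ.⊓ (N ∸ r)

  reflect≤H : ∀ r → reflect r ≤ H
  reflect≤H r with ℕ.≤-total r H
  ... | inj₁ r≤H = ℕ.≤-trans (ℕ.m⊓n≤m r (N ∸ r)) r≤H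
  ... | inj₂ H≤r = ℕ.≤-trans (ℕ.m⊓n≤n r (N ∸ r)) (begin
    N ∸ r       ≤⟨ ℕ.∸-monoʳ-≤ N H≤r ⟩
    N ∸ H       ≡⟨ cong (_∸ H) N≡H+H ⟩
    H ℕ.+ H ∸ H ≡⟨ ℕ.m+n∸m≡n H H ⟩
    H           ∎)
    where open ℕ.≤-Reasoning

  rep : ℤ → ℤ
  rep x = + reflect (x %ℕ N)

  rep-InHalfPeriod : ∀ x → InHalfPeriod (rep x)
  rep-InHalfPeriod x = +≤+ z≤n , +≤+ (reflect≤H (x %ℕ N))

  reflect-≡± : ∀ {x r q} → r ≤ N → x ≡ + r + q * + N → + reflect r ≡± x mod N
  reflect-≡± {x} {r} {q} r≤N x≡ with ℕ.⊓-sel r (N ∸ r)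
  ... | inj₁ reflect≡r =
    subst (λ m → + m ≡± x mod N) (sym reflect≡r) (plus (mod-sym (congruent q x≡)))
  ... | inj₂ reflect≡N∸r =
    subst (λ m → + m ≡± x mod N) (sym reflect≡N∸r) (minus (congruent (+ 1 + q) (begin
      + (N ∸ r)                           ≡⟨ trans (ℤ.m-n≡m⊖n N r) (ℤ.⊖-≥ r≤N) ⟨
      + N - + r                           ≡⟨ flip (+ r) q (+ N) ⟩
      - (+ r + q * + N) + (+ 1 + q) * + N ≡⟨ cong (λ v → - v + (+ 1 + q) * + N) x≡ ⟨
      - x + (+ 1 + q) * + N               ∎)))
    where
    open ≡-Reasoning
    flip : ∀ r q M → M - r ≡ - (r + q * M) + (+ 1 + q) * M
    flip = solve-∀

  rep-≡± : ∀ x → rep x ≡± x mod N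
  rep-≡± x = reflect-≡± {q = x /ℕ N} (ℕ.<⇒≤ (n%ℕd<d x N)) (a≡a%ℕn+[a/ℕn]*n x N)

  open Transversal ±-isEquivalence InHalfPeriod-unique rep rep-InHalfPeriod rep-≡±
  open Folding {λ _ → ⊤} {λ x y → x ≡± y mod N} n rep rep-≡± rep-resp _
    (rep-fix ∘ InN⇒InHalfPeriod) _

  odd-periodic-fixes-H : ∀ {f} → Odd-symmetric f → Periodic N f → f (+ H) ≡ + H
  odd-periodic-fixes-H {f} f-odd f-periodic = ℤ.*-cancelˡ-≡ (+ 2) (f (+ H)) (+ H) (begin
    + 2 * f (+ H)                 ≡⟨ double (f (+ H)) ⟩
    f (+ H) + f (+ H)             ≡⟨ cong (_+_ (f (+ H))) fH≡ ⟩
    f (+ H) + (- f (+ H) + + N)   ≡⟨ cancel (f (+ H)) (+ N) ⟩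
    + N                           ≡⟨ +N≡H+H ⟩
    + H + + H                     ≡⟨ double (+ H) ⟨
    + 2 * + H                     ∎)
    where
    open ≡-Reasoning
    double : ∀ a → + 2 * a ≡ a + a
    double = solve-∀
    cancel : ∀ a M → a + (- a + M) ≡ M
    cancel = solve-∀
    +N≡H+H : + N ≡ + H + + H
    +N≡H+H = trans (cong +_ N≡H+H) (ℤ.pos-+ H H)
    halve : ∀ a → - a + (a + a) ≡ a
    halve = solve-∀
    -H+N≡H : - + H + + N ≡ + H
    -H+N≡H = trans (cong (λ v → - + H + v) +N≡H+H) (halve (+ H))
    fH≡ : f (+ H) ≡ - f (+ H) + + N
    fH≡ = begin
      f (+ H)             ≡⟨ cong f -H+N≡H ⟨
      f (- + H + + N)     ≡⟨ f-periodic (- + H) ⟩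
      f (- + H) + + N     ≡⟨ cong (_+ + N) (f-odd (+ H)) ⟩
      - f (+ H) + + N     ∎

  interior : ∀ {m} → m ≤ H → m ≢ 0 → m ≢ H → InN n (+ m)
  interior {zero}  _         m≢0 _   = ⊥-elim (m≢0 refl)
  interior {suc m} (s≤s m≤n) _   m≢H = +≤+ (s≤s z≤n) , +≤+ (ℕ.≤∧≢⇒< m≤n (m≢H ∘ cong suc))

  -- The classes of 0 and H are fixed by g, and g ∘ f = id, so no window point folds onto them.
  folds-into : ∀ f g → Odd-symmetric g → Periodic N g → (∀ x → g (f x) ≡ x) → FoldsInto f
  folds-into f g g-odd g-periodic g∘f {i} i∈ = interior (reflect≤H _)
    (λ m≡0 → 0∉InN (subst (InN n) (collapses 0∈ (odd-fixes-0 g-odd) (cong +_ m≡0)) i∈))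
    (λ m≡H → H∉InN (subst (InN n)
      (collapses H∈ (odd-periodic-fixes-H g-odd g-periodic) (cong +_ m≡H)) i∈))
    where
    0∈ : InHalfPeriod (+ 0)
    0∈ = +≤+ z≤n , +≤+ z≤n
    H∈ : InHalfPeriod (+ H)
    H∈ = +≤+ z≤n , +≤+ ℕ.≤-refl
    0∉InN : ¬ InN n (+ 0)
    0∉InN (+≤+ () , _)
    H∉InN : ¬ InN n (+ H)
    H∉InN (_ , +≤+ H≤n) = ℕ.<-irrefl refl H≤n
    collapses : ∀ {s} → InHalfPeriod s → g s ≡ s → rep (f i) ≡ s → i ≡ s
    collapses {s} s∈ gs≡s fi≡s = begin
      i                   ≡⟨ rep-cancel {f} {g} _ g-resp (λ x _ → g∘f x) i∈ ⟨
      rep (g (rep (f i))) ≡⟨ cong (rep ∘ g) fi≡s ⟩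
      rep (g s)           ≡⟨ cong rep gs≡s ⟩
      rep s               ≡⟨ rep-fix s∈ ⟩
      s                   ∎
      where
      open ≡-Reasoning
      g-resp : RespectsOn (λ _ → ⊤) (λ x y → x ≡± y mod N) g
      g-resp _ _ = odd-periodic-resp g-odd g-periodic

  tvd-subadditive : ∀ (u w : BijOn (λ _ → ⊤)) → CondC n (fun u) → CondC n (fun w) →
    tvd n (fun u ∘ fun w) ≤ tvd n (fun u) ℕ.+ tvd n (fun w)
  tvd-subadditive u w (u-odd , u-periodic) (w-odd , w-periodic) =
    tvd-∘-≤-by-folding (fun u) w
      (λ _ _ → odd-periodic-resp w-odd w-periodic)
      (λ _ _ → odd-periodic-resp w⁻¹-odd w⁻¹-periodic)
      (folds-into (fun w) (inv w) w⁻¹-odd w⁻¹-periodic (λ x → inv∘fun w x tt))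
      (folds-into (inv w) (fun w) w-odd w-periodic (λ x → fun∘inv w x tt))
      (λ x _ → disp-odd-periodic u-odd u-periodic (rep-≡± x))
    where
    w⁻¹-odd : Odd-symmetric (inv w)
    w⁻¹-odd = inv-odd w w-odd
    w⁻¹-periodic : Periodic N (inv w)
    w⁻¹-periodic = inv-periodic w w-periodic

proposition3p2 : (g : George) (n : ℕ) → 1 ≤ n → (u w : Elem g n) →
    tvd n (λ i → ⟦ u ⟧ (⟦ w ⟧ i)) ≤ tvd n ⟦ u ⟧ ℕ.+ tvd n ⟦ w ⟧
proposition3p2 typeA n _ u w = tvd-∘-≤-by-permutation n ⟦ u ⟧ ⟦ w ⟧ (bij w) (λ _ → refl)
proposition3p2 typeB n _ u w = Signed.tvd-subadditive n (bij u) (bij w) (cond u) (cond w)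
proposition3p2 typeD n _ u w =
  Signed.tvd-subadditive n (bij u) (bij w) (proj₁ (cond u)) (proj₁ (cond w))
proposition3p2 affA n 1≤n u w =
  AffineA.tvd-subadditive n {{ℕ.>-nonZero 1≤n}} (bij u) (bij w) (proj₁ (cond u)) (proj₁ (cond w))
proposition3p2 affC n _ u w = AffineC.tvd-subadditive n (bij u) (bij w) (cond u) (cond w)
proposition3p2 affB n _ u w =
  AffineC.tvd-subadditive n (bij u) (bij w) (proj₁ (cond u)) (proj₁ (cond w))
proposition3p2 affD n _ u w =
  AffineC.tvd-subadditive n (bij u) (bij w) (proj₁ (cond u)) (proj₁ (cond w))
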